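{- Let $1\le m<n$ and let $\pi$ be chosen uniformly at random from $\mathrm{PF}(m,n)$. Denote by $k_1(\pi)<\dots<k_{n-m}(\pi)$ the $n-m$ spots unattempted by any car. Then $$\mathbb E(k_i(\pi))=i\,\frac{n+1}{n-m+1}\qquad\text{for all }i=1,\dots,n-m.$$
   Context: $\mathrm{PF}(m,n)$ is the set of sequences $\pi\in\{1,\dots,n\}^m$ such that, when spots $1,\dots,n$ are initially empty and for $i=1,\dots,m$ in turn car $i$ goes to spot $\pi_i$ and parks in the first empty spot among $\pi_i,\pi_i+1,\dots,n$, every car parks. A spot is unattempted if no car ever arrives at it; for $\pi\in\mathrm{PF}(m,n)$ these are exactly the $n-m$ spots left empty. -}

module Defs where

open import Data.Nat using (ℕ; zero; suc; _≤ᵇ_; _≡ᵇ_)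
open import Data.Bool using (Bool; true; false; _∧_; _∨_; not; if_then_else_)
open import Data.List using (List; []; _∷_; map; upTo; concatMap; [_])
open import Data.Maybe using (Maybe; just; nothing; is-just)

filterᵇ : {A : Set} → (A → Bool) → List A → List A
filterᵇ f [] = []
filterᵇ f (x ∷ xs) = if f x then x ∷ filterᵇ f xs else filterᵇ f xs

spots : ℕ → List ℕ
spots n = map suc (upTo n)

memberᵇ : ℕ → List ℕ → Bool
memberᵇ x [] = false
memberᵇ x (y ∷ ys) = (x ≡ᵇ y) ∨ memberᵇ x ys

headM : List ℕ → Maybe ℕ
headM [] = nothing
headM (x ∷ _) = just x

firstFree : ℕ → List ℕ → ℕ → Maybe ℕ
firstFree n occ p = headM (filterᵇ (λ s → (p ≤ᵇ s) ∧ not (memberᵇ s occ)) (spots n))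

consM : ℕ → Maybe (List ℕ) → Maybe (List ℕ)
consM s nothing = nothing
consM s (just xs) = just (s ∷ xs)

-- cars arrive in order with preferences given by the list; result is the list of
-- parking positions (car by car), or nothing if some car fails to park
parkFrom : ℕ → List ℕ → Maybe ℕ → List ℕ → Maybe (List ℕ)
parkAll : ℕ → List ℕ → List ℕ → Maybe (List ℕ)
parkAll n occ [] = just []
parkAll n occ (p ∷ ps) = parkFrom n occ (firstFree n occ p) ps
parkFrom n occ nothing ps = nothing
parkFrom n occ (just s) ps = consM s (parkAll n (s ∷ occ) ps)

sequences : ℕ → ℕ → List (List ℕ)
sequences zero n = [ [] ]
sequences (suc m) n = concatMap (λ p → map (p ∷_) (sequences m n)) (spots n)

isPF : ℕ → List ℕ → Bool
isPF n π = is-just (parkAll n [] π)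

-- PF(m,n) enumerated as a list (without repetitions)
PF : ℕ → ℕ → List (List ℕ)
PF m n = filterᵇ (isPF n) (sequences m n)

-- spot j is attempted if some car i arrives at it: π_i ≤ j ≤ (where car i parked)
attemptedᵇ : ℕ → List ℕ → List ℕ → Bool
attemptedᵇ j (p ∷ ps) (s ∷ ss) = ((p ≤ᵇ j) ∧ (j ≤ᵇ s)) ∨ attemptedᵇ j ps ss
attemptedᵇ j _ _ = false

unattemptedFrom : ℕ → List ℕ → Maybe (List ℕ) → List ℕ
unattemptedFrom n π nothing = []
unattemptedFrom n π (just pos) = filterᵇ (λ j → not (attemptedᵇ j π pos)) (spots n)

unattempted : ℕ → List ℕ → List ℕ
unattempted n π = unattemptedFrom n π (parkAll n [] π)

nthOr0 : ℕ → List ℕ → ℕ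
nthOr0 _ [] = 0
nthOr0 zero (x ∷ _) = x
nthOr0 (suc i) (_ ∷ xs) = nthOr0 i xs

-- k_i(π) for 1 ≤ i (1-indexed)
k : ℕ → ℕ → List ℕ → ℕ
k n i π = nthOr0 (i Data.Nat.∸ 1) (unattempted n π)

-- Pollak's circle argument. Add a spot N = n + 1 and let cars park on the circle 1, …, N, wrapping
-- from N to 1. A sequence σ ∈ {1, …, N}^m is a parking function for n exactly when circular parking
-- leaves N empty, and then linear and circular parking agree and the unattempted spots are the empty
-- ones. Rotating all preferences commutes with circular parking and permutes {1, …, N}^m, so the sum
-- of k_i over PF(m, n) may be averaged over the N rotations of each σ. The rotations of σ leaving N
-- empty correspond to the n − m + 1 empty spots c of σ, and k_i of such a rotation is the distance
-- from c to the i-th empty spot after c. Summed over all c these distances cover i full turns of the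
-- circle, i·N, which gives (n − m + 1)·Σ k_i = i·(n + 1)·|PF(m, n)|.
module Submission where

open import Data.Bool using (Bool; true; false; _∧_; _∨_; not; if_then_else_)
open import Data.Bool.Properties using (T-≡; ∧-identityʳ; ∧-conicalˡ; ∧-conicalʳ; not-involutive)
open import Data.Empty using (⊥-elim)
open import Data.List using (List; []; _∷_; [_]; _++_; map; length; concatMap; applyUpTo)
open import Data.List.Properties using (map-id; map-++; length-map; length-++; ++-assoc; map-∘; map-cong; map-cong-local)
open import Data.List.Relation.Unary.All as All using (All; []; _∷_)
open import Data.List.Relation.Unary.All.Properties using (map⁺)
open import Data.List.Relation.Unary.Any using (Any; here; there)
open import Data.Maybe using (just; nothing; fromMaybe)
open import Data.Nat using (ℕ; zero; suc; _+_; _*_; _∸_; _≤_; _<_; z≤n; s≤s; z<s; s<s; _≤ᵇ_; _≡ᵇ_; _≟_; _≤?_)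
open import Data.Nat.ListAction using (sum)
open import Data.Nat.ListAction.Properties using (sum-++)
open import Data.Nat.Properties
open import Algebra.Properties.CommutativeSemigroup +-commutativeSemigroup using (interchange)
open import Algebra.Properties.CommutativeSemigroup *-commutativeSemigroup using ()
  renaming (x∙yz≈y∙xz to x*[y*z]≡y*[x*z])
open import Data.Nat.Tactic.RingSolver using (solve-∀)
open import Data.Product using (Σ-syntax; _×_; _,_; proj₁)
open import Function using (id; _∘_)
open import Function.Bundles using (Equivalence)
open import Relation.Binary using (tri<; tri≈; tri>)
open import Relation.Binary.PropositionalEquality hiding ([_])
open import Relation.Nullary using (yes; no)
open import Defs

≡ᵇ-refl : ∀ x → (x ≡ᵇ x) ≡ true
≡ᵇ-refl x = Equivalence.to T-≡ (≡⇒≡ᵇ x x refl)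

≢⇒≡ᵇ-false : ∀ {x y} → x ≢ y → (x ≡ᵇ y) ≡ false
≢⇒≡ᵇ-false {x} {y} x≢y with x ≡ᵇ y in eq
... | true  = ⊥-elim (x≢y (≡ᵇ⇒≡ x y (Equivalence.from T-≡ eq)))
... | false = refl

≤⇒≤ᵇ-true : ∀ {m n} → m ≤ n → (m ≤ᵇ n) ≡ true
≤⇒≤ᵇ-true m≤n = Equivalence.to T-≡ (≤⇒≤ᵇ m≤n)

≤ᵇ-true⇒≤ : ∀ {m n} → (m ≤ᵇ n) ≡ true → m ≤ n
≤ᵇ-true⇒≤ {m} {n} eq = ≤ᵇ⇒≤ m n (Equivalence.from T-≡ eq)

memberᵇ-∷-false : ∀ {x y ys} → x ≢ y → memberᵇ x ys ≡ false → memberᵇ x (y ∷ ys) ≡ false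
memberᵇ-∷-false x≢y x∉ys rewrite ≢⇒≡ᵇ-false x≢y = x∉ys

>⇒≤ᵇ-false : ∀ {m n} → n < m → (m ≤ᵇ n) ≡ false
>⇒≤ᵇ-false {m} {n} n<m with m ≤ᵇ n in eq
... | true  = ⊥-elim (<⇒≱ n<m (≤ᵇ-true⇒≤ eq))
... | false = refl

module _ {A : Set} where

  sum-map-+ : ∀ (f g : A → ℕ) xs → sum (map (λ x → f x + g x) xs) ≡ sum (map f xs) + sum (map g xs)
  sum-map-+ f g []       = refl
  sum-map-+ f g (x ∷ xs) = trans (cong (f x + g x +_) (sum-map-+ f g xs)) (interchange (f x) (g x) _ _)

  sum-map-*ˡ : ∀ c (f : A → ℕ) xs → sum (map (λ x → c * f x) xs) ≡ c * sum (map f xs)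
  sum-map-*ˡ c f []       = sym (*-zeroʳ c)
  sum-map-*ˡ c f (x ∷ xs) = trans (cong (c * f x +_) (sum-map-*ˡ c f xs)) (sym (*-distribˡ-+ c (f x) _))

  sum-map-const : ∀ c (xs : List A) → sum (map (λ _ → c) xs) ≡ length xs * c
  sum-map-const c []       = refl
  sum-map-const c (x ∷ xs) = cong (c +_) (sum-map-const c xs)

  sum-map-zero : ∀ {f : A → ℕ} → (∀ x → f x ≡ 0) → ∀ xs → sum (map f xs) ≡ 0
  sum-map-zero f≗0 []       = refl
  sum-map-zero f≗0 (x ∷ xs) = cong₂ _+_ (f≗0 x) (sum-map-zero f≗0 xs)

  length≡sum-map-1 : ∀ (xs : List A) → length xs ≡ sum (map (λ _ → 1) xs)
  length≡sum-map-1 xs = sym (trans (sum-map-const 1 xs) (*-identityʳ (length xs)))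

  sum-map-cong-All : ∀ {P : A → Set} {f g : A → ℕ} → (∀ {x} → P x → f x ≡ g x) →
                     ∀ {xs} → All P xs → sum (map f xs) ≡ sum (map g xs)
  sum-map-cong-All f≗g pxs = cong sum (map-cong-local (All.map f≗g pxs))

  sum-map-filterᵇ : ∀ (p : A → Bool) (f : A → ℕ) xs →
                    sum (map f (filterᵇ p xs)) ≡ sum (map (λ x → if p x then f x else 0) xs)
  sum-map-filterᵇ p f []       = refl
  sum-map-filterᵇ p f (x ∷ xs) with p x
  ... | true  = cong (f x +_) (sum-map-filterᵇ p f xs)
  ... | false = sum-map-filterᵇ p f xs

  length-filterᵇ : ∀ (p : A → Bool) xs → length (filterᵇ p xs) ≡ sum (map (λ x → if p x then 1 else 0) xs)
  length-filterᵇ p xs = trans (length≡sum-map-1 (filterᵇ p xs)) (sum-map-filterᵇ p (λ _ → 1) xs)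

  filterᵇ-++ : ∀ (p : A → Bool) xs ys → filterᵇ p (xs ++ ys) ≡ filterᵇ p xs ++ filterᵇ p ys
  filterᵇ-++ p []       ys = refl
  filterᵇ-++ p (x ∷ xs) ys with p x
  ... | true  = cong (x ∷_) (filterᵇ-++ p xs ys)
  ... | false = filterᵇ-++ p xs ys

  filterᵇ-cong-All : ∀ {P : A → Set} {p q : A → Bool} → (∀ {x} → P x → p x ≡ q x) →
                     ∀ {xs} → All P xs → filterᵇ p xs ≡ filterᵇ q xs
  filterᵇ-cong-All         p≗q []                   = refl
  filterᵇ-cong-All {q = q} p≗q (_∷_ {x} px pxs) rewrite p≗q px with q x
  ... | true  = cong (x ∷_) (filterᵇ-cong-All p≗q pxs)
  ... | false = filterᵇ-cong-All p≗q pxs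

  filterᵇ-cong : ∀ {p q : A → Bool} → (∀ x → p x ≡ q x) → ∀ xs → filterᵇ p xs ≡ filterᵇ q xs
  filterᵇ-cong         p≗q []       = refl
  filterᵇ-cong {q = q} p≗q (x ∷ xs) rewrite p≗q x with q x
  ... | true  = cong (x ∷_) (filterᵇ-cong p≗q xs)
  ... | false = filterᵇ-cong p≗q xs

  filterᵇ-accept : ∀ (xs : List A) → filterᵇ (λ _ → true) xs ≡ xs
  filterᵇ-accept []       = refl
  filterᵇ-accept (x ∷ xs) = cong (x ∷_) (filterᵇ-accept xs)

  sum-concatMap : ∀ {B : Set} (f : B → ℕ) (g : A → List B) xs →
                  sum (map f (concatMap g xs)) ≡ sum (map (λ x → sum (map f (g x))) xs)
  sum-concatMap f g []       = refl
  sum-concatMap f g (x ∷ xs) = begin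
    sum (map f (g x ++ concatMap g xs))          ≡⟨ cong sum (map-++ f (g x) _) ⟩
    sum (map f (g x) ++ map f (concatMap g xs))  ≡⟨ sum-++ (map f (g x)) _ ⟩
    sum (map f (g x)) + sum (map f (concatMap g xs)) ≡⟨ cong (sum (map f (g x)) +_) (sum-concatMap f g xs) ⟩
    sum (map f (g x)) + sum (map (λ x → sum (map f (g x))) xs) ∎
    where open ≡-Reasoning

sum-map-sum-comm : ∀ {A B : Set} (h : A → B → ℕ) xs ys →
  sum (map (λ x → sum (map (h x) ys)) xs) ≡ sum (map (λ y → sum (map (λ x → h x y) xs)) ys)
sum-map-sum-comm h []       ys = sym (sum-map-zero (λ _ → refl) ys)
sum-map-sum-comm h (x ∷ xs) ys =
  trans (cong (sum (map (h x) ys) +_) (sum-map-sum-comm h xs ys)) (sym (sum-map-+ (h x) _ ys))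

filterᵇ-map : ∀ {A B : Set} (p : B → Bool) (f : A → B) xs → filterᵇ p (map f xs) ≡ map f (filterᵇ (λ x → p (f x)) xs)
filterᵇ-map p f []       = refl
filterᵇ-map p f (x ∷ xs) with p (f x)
... | true  = cong (f x ∷_) (filterᵇ-map p f xs)
... | false = filterᵇ-map p f xs

nthOr0-++ˡ : ∀ j xs ys → j < length xs → nthOr0 j (xs ++ ys) ≡ nthOr0 j xs
nthOr0-++ˡ zero    (x ∷ xs) ys _         = refl
nthOr0-++ˡ (suc j) (x ∷ xs) ys (s≤s j<l) = nthOr0-++ˡ j xs ys j<l

nthOr0-++ʳ : ∀ j xs ys → nthOr0 (length xs + j) (xs ++ ys) ≡ nthOr0 j ys
nthOr0-++ʳ j []       ys = refl
nthOr0-++ʳ j (x ∷ xs) ys = nthOr0-++ʳ j xs ys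

nthOr0-map : ∀ (f : ℕ → ℕ) j xs → j < length xs → nthOr0 j (map f xs) ≡ f (nthOr0 j xs)
nthOr0-map f zero    (x ∷ xs) _         = refl
nthOr0-map f (suc j) (x ∷ xs) (s≤s j<l) = nthOr0-map f j xs j<l

∑< : ℕ → (ℕ → ℕ) → ℕ
∑< zero    f = 0
∑< (suc L) f = f 0 + ∑< L (λ u → f (suc u))

∑<-cong : ∀ L {f g : ℕ → ℕ} → (∀ {u} → u < L → f u ≡ g u) → ∑< L f ≡ ∑< L g
∑<-cong zero    f≗g = refl
∑<-cong (suc L) f≗g = cong₂ _+_ (f≗g z<s) (∑<-cong L (λ u<L → f≗g (s<s u<L)))

∑<-sucʳ : ∀ L (f : ℕ → ℕ) → ∑< (suc L) f ≡ ∑< L f + f L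
∑<-sucʳ zero    f = +-comm (f 0) 0
∑<-sucʳ (suc L) f = trans (cong (f 0 +_) (∑<-sucʳ L (λ u → f (suc u)))) (sym (+-assoc (f 0) _ _))

sum≡∑<-nthOr0 : ∀ xs → sum xs ≡ ∑< (length xs) (λ u → nthOr0 u xs)
sum≡∑<-nthOr0 []       = refl
sum≡∑<-nthOr0 (x ∷ xs) = cong (x +_) (sum≡∑<-nthOr0 xs)

∑<-translate : ∀ L N (t : ℕ → ℕ) → (∀ {u} → u < L → t (L + u) ≡ t u + N) →
               ∀ j → j ≤ L → ∑< L (λ u → t (u + j)) ≡ ∑< L t + j * N
∑<-translate L N t period zero    _ =
  trans (∑<-cong L (λ {u} _ → cong t (+-identityʳ u))) (sym (+-identityʳ _))
∑<-translate L N t period (suc j) j<L = +-cancelʳ-≡ (t j) _ _ (begin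
  ∑< L (λ u → t (u + suc j)) + t j      ≡⟨ cong (_+ t j) (∑<-cong L (λ {u} _ → cong t (+-suc u j))) ⟩
  ∑< L (λ u → t (suc u + j)) + t j      ≡⟨ +-comm _ (t j) ⟩
  ∑< (suc L) (λ u → t (u + j))          ≡⟨ ∑<-sucʳ L (λ u → t (u + j)) ⟩
  ∑< L (λ u → t (u + j)) + t (L + j)    ≡⟨ cong₂ _+_ (∑<-translate L N t period j (<⇒≤ j<L)) (period j<L) ⟩
  ∑< L t + j * N + (t j + N)            ≡⟨ rearrange (∑< L t) j (t j) N ⟩
  ∑< L t + suc j * N + t j              ∎)
  where
  open ≡-Reasoning
  rearrange : ∀ a b c d → a + b * d + (c + d) ≡ a + suc b * d + c
  rearrange = solve-∀

interval : ℕ → ℕ → List ℕ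
interval a zero    = []
interval a (suc d) = suc a ∷ interval (suc a) d

interval-++ : ∀ a j d → interval a (j + d) ≡ interval a j ++ interval (a + j) d
interval-++ a zero    d = cong (λ b → interval b d) (sym (+-identityʳ a))
interval-++ a (suc j) d =
  cong (suc a ∷_) (trans (interval-++ (suc a) j d) (cong (λ b → interval (suc a) j ++ interval b d) (sym (+-suc a j))))

interval-∷ʳ : ∀ a d → interval a (suc d) ≡ interval a d ++ [ suc (a + d) ]
interval-∷ʳ a d = trans (cong (interval a) (+-comm 1 d)) (interval-++ a d 1)

map-+-interval : ∀ b a d → map (b +_) (interval a d) ≡ interval (b + a) d
map-+-interval b a zero    = refl
map-+-interval b a (suc d) =
  cong₂ _∷_ (+-suc b a) (trans (map-+-interval b (suc a) d) (cong (λ c → interval c d) (+-suc b a)))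

length-interval : ∀ a d → length (interval a d) ≡ d
length-interval a zero    = refl
length-interval a (suc d) = cong suc (length-interval (suc a) d)

interval-bounds : ∀ a d → All (λ x → a < x × x ≤ a + d) (interval a d)
interval-bounds a zero    = []
interval-bounds a (suc d) =
  (≤-refl , subst (suc a ≤_) (sym (+-suc a d)) (s≤s (m≤m+n a d))) ∷ All.map widen (interval-bounds (suc a) d)
  where
  widen : ∀ {x} → suc a < x × x ≤ suc a + d → a < x × x ≤ a + suc d
  widen {x} (a+1<x , x≤) = <-trans (n<1+n a) a+1<x , subst (x ≤_) (sym (+-suc a d)) x≤

spots≡interval : ∀ n → spots n ≡ interval 0 n
spots≡interval = map-suc-applyUpTo id 0 (λ _ → refl)
  where
  map-suc-applyUpTo : ∀ (f : ℕ → ℕ) a → (∀ x → f x ≡ a + x) → ∀ d → map suc (applyUpTo f d) ≡ interval a d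
  map-suc-applyUpTo f a f≗a+ zero    = refl
  map-suc-applyUpTo f a f≗a+ (suc d) =
    cong₂ _∷_ (cong suc (trans (f≗a+ 0) (+-identityʳ a)))
              (map-suc-applyUpTo (λ x → f (suc x)) (suc a) (λ x → trans (f≗a+ (suc x)) (+-suc a x)) d)

length-spots : ∀ n → length (spots n) ≡ n
length-spots n = trans (cong length (spots≡interval n)) (length-interval 0 n)

spots-bounds : ∀ n → All (λ x → 0 < x × x ≤ n) (spots n)
spots-bounds n = subst (All _) (sym (spots≡interval n)) (interval-bounds 0 n)

spots-∷ʳ : ∀ n → spots (suc n) ≡ spots n ++ [ suc n ]
spots-∷ʳ n = trans (spots≡interval (suc n)) (trans (interval-∷ʳ 0 n) (cong (_++ [ suc n ]) (sym (spots≡interval n))))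

count : ℕ → List ℕ → ℕ
count s xs = length (filterᵇ (λ x → x ≡ᵇ s) xs)

count-interval-outside : ∀ s a d → s ≤ a → count s (interval a d) ≡ 0
count-interval-outside s a zero    _   = refl
count-interval-outside s a (suc d) s≤a rewrite ≢⇒≡ᵇ-false (≢-sym (<⇒≢ (s≤s s≤a))) =
  count-interval-outside s (suc a) d (m≤n⇒m≤1+n s≤a)

count-interval-inside : ∀ s a d → a < s → s ≤ a + d → count s (interval a d) ≡ 1
count-interval-inside s a zero    a<s s≤a+0 = ⊥-elim (<⇒≱ a<s (subst (s ≤_) (+-identityʳ a) s≤a+0))
count-interval-inside s a (suc d) a<s s≤    with suc a ≟ s
... | yes refl rewrite ≡ᵇ-refl (suc a) = cong suc (count-interval-outside (suc a) (suc a) d ≤-refl)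
... | no a+1≢s rewrite ≢⇒≡ᵇ-false a+1≢s =
  count-interval-inside s (suc a) d (≤∧≢⇒< a<s a+1≢s) (subst (s ≤_) (+-suc a d) s≤)

head-filterᵇ-interval : ∀ (g : ℕ → Bool) q d {s} → headM (filterᵇ g (interval q d)) ≡ just s →
  q < s × s ≤ q + d × g s ≡ true × (∀ {j} → q < j → j < s → g j ≡ false)
head-filterᵇ-interval g q (suc d) {s} eq with g (suc q) in gq | eq
... | true  | refl = ≤-refl , subst (suc q ≤_) (sym (+-suc q d)) (s≤s (m≤m+n q d)) , gq ,
                     λ q<j j<q+1 → ⊥-elim (<⇒≱ j<q+1 q<j)
... | false | eq′ with head-filterᵇ-interval g (suc q) d eq′
...   | q+1<s , s≤ , gs , skipped =
  <-trans (n<1+n q) q+1<s , subst (s ≤_) (sym (+-suc q d)) s≤ , gs , skipped′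
  where
  skipped′ : ∀ {j} → q < j → j < s → g j ≡ false
  skipped′ {j} q<j j<s with suc q ≟ j
  ... | yes refl    = gq
  ... | no q+1≢j    = skipped (≤∧≢⇒< q<j q+1≢j) j<s

filterᵇ-below : ∀ (g : ℕ → Bool) p a d → a + d < p → filterᵇ (λ x → (p ≤ᵇ x) ∧ g x) (interval a d) ≡ []
filterᵇ-below g p a zero    _     = refl
filterᵇ-below g p a (suc d) a+d<p
  with a+1+d<p ← subst (_< p) (+-suc a d) a+d<p
  rewrite >⇒≤ᵇ-false (≤-<-trans (s≤s (m≤m+n a d)) a+1+d<p) = filterᵇ-below g p (suc a) d a+1+d<p

module PeriodicMarks (N : ℕ) (marked : ℕ → Bool) (periodic : ∀ y → marked (N + y) ≡ marked y) where

  marksIn : ℕ → ℕ → List ℕ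
  marksIn a d = filterᵇ marked (interval a d)

  marks : List ℕ
  marks = marksIn 0 N

  twoPeriods : List ℕ
  twoPeriods = marks ++ map (N +_) marks

  offsets : ℕ → List ℕ
  offsets c = filterᵇ (λ x → marked (c + x)) (interval 0 N)

  -- distance from c to the (j + 1)-th marked point after c
  gap : ℕ → ℕ → ℕ
  gap j c = nthOr0 j (offsets c)

  marks-split : ∀ {c} → c ≤ N → marks ≡ marksIn 0 c ++ marksIn c (N ∸ c)
  marks-split {c} c≤N = begin
    marksIn 0 N                                             ≡⟨ cong (marksIn 0) (sym (m+[n∸m]≡n c≤N)) ⟩
    filterᵇ marked (interval 0 (c + (N ∸ c)))               ≡⟨ cong (filterᵇ marked) (interval-++ 0 c (N ∸ c)) ⟩
    filterᵇ marked (interval 0 c ++ interval c (N ∸ c))     ≡⟨ filterᵇ-++ marked (interval 0 c) _ ⟩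
    marksIn 0 c ++ marksIn c (N ∸ c)                        ∎
    where open ≡-Reasoning

  window-split : ∀ {c} → c ≤ N → marksIn c N ≡ marksIn c (N ∸ c) ++ map (N +_) (marksIn 0 c)
  window-split {c} c≤N = begin
    filterᵇ marked (interval c N)
      ≡⟨ cong (marksIn c) (sym (m∸n+n≡m c≤N)) ⟩
    filterᵇ marked (interval c (N ∸ c + c))
      ≡⟨ cong (filterᵇ marked) (interval-++ c (N ∸ c) c) ⟩
    filterᵇ marked (interval c (N ∸ c) ++ interval (c + (N ∸ c)) c)
      ≡⟨ filterᵇ-++ marked (interval c (N ∸ c)) _ ⟩
    Q ++ filterᵇ marked (interval (c + (N ∸ c)) c)
      ≡⟨ cong (λ a → Q ++ filterᵇ marked (interval a c)) (trans (m+[n∸m]≡n c≤N) (sym (+-identityʳ N))) ⟩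
    Q ++ filterᵇ marked (interval (N + 0) c)
      ≡⟨ cong (λ xs → Q ++ filterᵇ marked xs) (sym (map-+-interval N 0 c)) ⟩
    Q ++ filterᵇ marked (map (N +_) (interval 0 c))
      ≡⟨ cong (Q ++_) (filterᵇ-map marked (N +_) (interval 0 c)) ⟩
    Q ++ map (N +_) (filterᵇ (λ x → marked (N + x)) (interval 0 c))
      ≡⟨ cong (λ xs → Q ++ map (N +_) xs) (filterᵇ-cong periodic (interval 0 c)) ⟩
    Q ++ map (N +_) (marksIn 0 c) ∎
    where
    open ≡-Reasoning
    Q : List ℕ
    Q = marksIn c (N ∸ c)

  length-window : ∀ {c} → c ≤ N → length (marksIn c N) ≡ length marks
  length-window {c} c≤N = begin
    length (marksIn c N)                  ≡⟨ cong length (window-split c≤N) ⟩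
    length (Q ++ map (N +_) P)            ≡⟨ length-++ Q ⟩
    length Q + length (map (N +_) P)      ≡⟨ cong (length Q +_) (length-map (N +_) P) ⟩
    length Q + length P                   ≡⟨ +-comm (length Q) (length P) ⟩
    length P + length Q                   ≡⟨ length-++ P ⟨
    length (P ++ Q)                       ≡⟨ cong length (marks-split c≤N) ⟨
    length marks                          ∎
    where
    open ≡-Reasoning
    P Q : List ℕ
    P = marksIn 0 c
    Q = marksIn c (N ∸ c)

  window≡map-offsets : ∀ c → marksIn c N ≡ map (c +_) (offsets c)
  window≡map-offsets c = begin
    filterᵇ marked (interval c N)             ≡⟨ cong (λ a → marksIn a N) (sym (+-identityʳ c)) ⟩
    filterᵇ marked (interval (c + 0) N)       ≡⟨ cong (filterᵇ marked) (sym (map-+-interval c 0 N)) ⟩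
    filterᵇ marked (map (c +_) (interval 0 N)) ≡⟨ filterᵇ-map marked (c +_) (interval 0 N) ⟩
    map (c +_) (offsets c)                    ∎
    where open ≡-Reasoning

  length-offsets : ∀ {c} → c ≤ N → length (offsets c) ≡ length marks
  length-offsets {c} c≤N =
    trans (sym (length-map (c +_) (offsets c))) (trans (cong length (sym (window≡map-offsets c))) (length-window c≤N))

  +-gap : ∀ {j c} → c ≤ N → j < length marks → c + gap j c ≡ nthOr0 j (marksIn c N)
  +-gap {j} {c} c≤N j<L = sym (trans (cong (nthOr0 j) (window≡map-offsets c))
                                     (nthOr0-map (c +_) j (offsets c) (subst (j <_) (sym (length-offsets c≤N)) j<L)))

  nthOr0-window : ∀ {j c} → c ≤ N → j < length marks →
                  nthOr0 j (marksIn c N) ≡ nthOr0 (length (marksIn 0 c) + j) twoPeriods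
  nthOr0-window {j} {c} c≤N j<L = begin
    nthOr0 j (marksIn c N)                             ≡⟨ cong (nthOr0 j) (window-split c≤N) ⟩
    nthOr0 j (Q ++ map (N +_) P)                       ≡⟨ nthOr0-++ˡ j (Q ++ map (N +_) P) (map (N +_) Q) j<window ⟨
    nthOr0 j ((Q ++ map (N +_) P) ++ map (N +_) Q)     ≡⟨ nthOr0-++ʳ j P _ ⟨
    nthOr0 (length P + j) (P ++ ((Q ++ map (N +_) P) ++ map (N +_) Q)) ≡⟨ cong (nthOr0 (length P + j)) twoPeriods-split ⟨
    nthOr0 (length P + j) twoPeriods                   ∎
    where
    open ≡-Reasoning
    P Q : List ℕ
    P = marksIn 0 c
    Q = marksIn c (N ∸ c)
    j<window : j < length (Q ++ map (N +_) P)
    j<window = subst (j <_) (sym (trans (cong length (sym (window-split c≤N))) (length-window c≤N))) j<L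
    twoPeriods-split : twoPeriods ≡ P ++ ((Q ++ map (N +_) P) ++ map (N +_) Q)
    twoPeriods-split = begin
      marks ++ map (N +_) marks                                ≡⟨ cong (λ xs → xs ++ map (N +_) xs) (marks-split c≤N) ⟩
      (P ++ Q) ++ map (N +_) (P ++ Q)                          ≡⟨ cong ((P ++ Q) ++_) (map-++ (N +_) P Q) ⟩
      (P ++ Q) ++ (map (N +_) P ++ map (N +_) Q)               ≡⟨ ++-assoc P Q _ ⟩
      P ++ (Q ++ (map (N +_) P ++ map (N +_) Q))               ≡⟨ cong (P ++_) (++-assoc Q _ _) ⟨
      P ++ ((Q ++ map (N +_) P) ++ map (N +_) Q)               ∎

  rank : ℕ → ℕ
  rank c = length (marksIn 0 c)

  rank-suc : ∀ a → rank (suc a) ≡ rank a + (if marked (suc a) then 1 else 0)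
  rank-suc a = begin
    length (filterᵇ marked (interval 0 (suc a)))                    ≡⟨ cong (length ∘ filterᵇ marked) (interval-∷ʳ 0 a) ⟩
    length (filterᵇ marked (interval 0 a ++ [ suc a ]))             ≡⟨ cong length (filterᵇ-++ marked (interval 0 a) [ suc a ]) ⟩
    length (marksIn 0 a ++ filterᵇ marked [ suc a ])                ≡⟨ length-++ (marksIn 0 a) ⟩
    rank a + length (filterᵇ marked [ suc a ])                      ≡⟨ cong (rank a +_) (length-if (marked (suc a))) ⟩
    rank a + (if marked (suc a) then 1 else 0)                      ∎
    where
    open ≡-Reasoning
    length-if : ∀ b → length (if b then suc a ∷ [] else []) ≡ (if b then 1 else 0)
    length-if true  = refl
    length-if false = refl

  rank-marked : ∀ {c} → marked c ≡ true → 1 ≤ c → 1 ≤ rank c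
  rank-marked {suc a} marked-c _ rewrite rank-suc a | marked-c = subst (1 ≤_) (+-comm 1 (rank a)) (s≤s z≤n)

  sum-by-rank : ∀ (g : ℕ → ℕ) a d {t} → rank a ≡ t →
    sum (map (λ c → if marked c then g (rank c ∸ 1) else 0) (interval a d)) ≡ ∑< (length (marksIn a d)) (λ u → g (t + u))
  sum-by-rank g a zero    _ = refl
  sum-by-rank g a (suc d) {t} rank-a≡t with marked (suc a) in marked-a+1
  ... | true  = cong₂ _+_ (cong g (trans (cong (_∸ 1) rank-a+1) (sym (+-identityʳ t))))
                          (trans (sum-by-rank g (suc a) d rank-a+1)
                                 (∑<-cong (length (marksIn (suc a) d)) (λ {u} _ → cong g (sym (+-suc t u)))))
    where
    rank-a+1 : rank (suc a) ≡ suc t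
    rank-a+1 = trans (rank-suc a) (trans (cong₂ _+_ rank-a≡t (cong (λ b → if b then 1 else 0) marked-a+1)) (+-comm t 1))
  ... | false = sum-by-rank g (suc a) d rank-a+1
    where
    rank-a+1 : rank (suc a) ≡ t
    rank-a+1 = trans (rank-suc a) (trans (cong₂ _+_ rank-a≡t (cong (λ b → if b then 1 else 0) marked-a+1)) (+-identityʳ t))

  nthOr0-twoPeriods : ∀ {u} → u < length marks → nthOr0 (length marks + u) twoPeriods ≡ nthOr0 u twoPeriods + N
  nthOr0-twoPeriods {u} u<L = begin
    nthOr0 (length marks + u) twoPeriods   ≡⟨ nthOr0-++ʳ u marks _ ⟩
    nthOr0 u (map (N +_) marks)            ≡⟨ nthOr0-map (N +_) u marks u<L ⟩
    N + nthOr0 u marks                     ≡⟨ +-comm N _ ⟩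
    nthOr0 u marks + N                     ≡⟨ cong (_+ N) (nthOr0-++ˡ u marks _ u<L) ⟨
    nthOr0 u twoPeriods + N                ∎
    where open ≡-Reasoning

  sum-marks : sum (map (λ c → if marked c then c else 0) (interval 0 N)) ≡ ∑< (length marks) (λ u → nthOr0 u twoPeriods)
  sum-marks = begin
    sum (map (λ c → if marked c then c else 0) (interval 0 N))  ≡⟨ sum-map-filterᵇ marked id (interval 0 N) ⟨
    sum (map id marks)                                            ≡⟨ cong sum (map-id marks) ⟩
    sum marks                                                     ≡⟨ sum≡∑<-nthOr0 marks ⟩
    ∑< (length marks) (λ u → nthOr0 u marks)
      ≡⟨ ∑<-cong (length marks) (λ u<L → nthOr0-++ˡ _ marks _ u<L) ⟨
    ∑< (length marks) (λ u → nthOr0 u twoPeriods)                 ∎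
    where open ≡-Reasoning

  -- If c is the r-th marked point then c + gap j c is the (r + j + 1)-th point of twoPeriods, so
  -- summing c + gap j c over the marked c is summing one period of twoPeriods shifted by j + 1.
  sum-gap : ∀ {j} → j < length marks → sum (map (λ c → if marked c then gap j c else 0) (interval 0 N)) ≡ suc j * N
  sum-gap {j} j<L = +-cancelˡ-≡ (sum (map (λ c → if marked c then c else 0) (interval 0 N))) _ _ (begin
    sum (map (λ c → if marked c then c else 0) (interval 0 N)) + sum (map (λ c → if marked c then gap j c else 0) (interval 0 N))
      ≡⟨ sum-map-+ (λ c → if marked c then c else 0) (λ c → if marked c then gap j c else 0) (interval 0 N) ⟨
    sum (map (λ c → (if marked c then c else 0) + (if marked c then gap j c else 0)) (interval 0 N))
      ≡⟨ sum-map-cong-All ranked (interval-bounds 0 N) ⟩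
    sum (map (λ c → if marked c then t (rank c ∸ 1 + suc j) else 0) (interval 0 N))
      ≡⟨ sum-by-rank (λ r → t (r + suc j)) 0 N refl ⟩
    ∑< (length marks) (λ u → t (u + suc j))
      ≡⟨ ∑<-translate (length marks) N t nthOr0-twoPeriods (suc j) j<L ⟩
    ∑< (length marks) t + suc j * N
      ≡⟨ cong (_+ suc j * N) sum-marks ⟨
    sum (map (λ c → if marked c then c else 0) (interval 0 N)) + suc j * N ∎)
    where
    open ≡-Reasoning
    t : ℕ → ℕ
    t u = nthOr0 u twoPeriods
    ranked : ∀ {c} → 0 < c × c ≤ 0 + N →
      (if marked c then c else 0) + (if marked c then gap j c else 0) ≡ (if marked c then t (rank c ∸ 1 + suc j) else 0)
    ranked {c} (0<c , c≤N) with marked c in marked-c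
    ... | false = refl
    ... | true  = begin
      c + gap j c                        ≡⟨ +-gap c≤N j<L ⟩
      nthOr0 j (marksIn c N)             ≡⟨ nthOr0-window c≤N j<L ⟩
      t (rank c + j)                     ≡⟨ cong t (shift (rank c) (rank-marked marked-c 0<c)) ⟩
      t (rank c ∸ 1 + suc j)             ∎
      where
      shift : ∀ r → 1 ≤ r → r + j ≡ r ∸ 1 + suc j
      shift (suc r) _ = sym (+-suc r j)

∑seq : ℕ → ℕ → (List ℕ → ℕ) → ℕ
∑seq n m f = sum (map f (sequences m n))

∑seq-suc : ∀ n m f → ∑seq n (suc m) f ≡ sum (map (λ p → ∑seq n m (λ τ → f (p ∷ τ))) (spots n))
∑seq-suc n m f = trans (sum-concatMap f (λ p → map (p ∷_) (sequences m n)) (spots n))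
                       (cong sum (map-cong (λ p → cong sum (sym (map-∘ (sequences m n)))) (spots n)))

∑seq-cong : ∀ n m {f g : List ℕ → ℕ} →
            (∀ {σ} → All (λ x → 1 ≤ x × x ≤ n) σ → length σ ≡ m → f σ ≡ g σ) → ∑seq n m f ≡ ∑seq n m g
∑seq-cong n zero    f≗g = cong (_+ 0) (f≗g [] refl)
∑seq-cong n (suc m) {f} {g} f≗g = begin
  ∑seq n (suc m) f                                        ≡⟨ ∑seq-suc n m f ⟩
  sum (map (λ p → ∑seq n m (λ τ → f (p ∷ τ))) (spots n))  ≡⟨ sum-map-cong-All cong-tail (spots-bounds n) ⟩
  sum (map (λ p → ∑seq n m (λ τ → g (p ∷ τ))) (spots n))  ≡⟨ ∑seq-suc n m g ⟨
  ∑seq n (suc m) g                                        ∎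
  where
  open ≡-Reasoning
  cong-tail : ∀ {p} → 1 ≤ p × p ≤ n → ∑seq n m (λ τ → f (p ∷ τ)) ≡ ∑seq n m (λ τ → g (p ∷ τ))
  cong-tail p∈ = ∑seq-cong n m (λ τ∈ |τ|≡m → f≗g (p∈ ∷ τ∈) (cong suc |τ|≡m))

∑seq-restrict : ∀ n m {f : List ℕ → ℕ} → (∀ {σ} → Any (n <_) σ → f σ ≡ 0) → ∑seq (suc n) m f ≡ ∑seq n m f
∑seq-restrict n zero            f-out = refl
∑seq-restrict n (suc m) {f} f-out = begin
  ∑seq (suc n) (suc m) f                             ≡⟨ ∑seq-suc (suc n) m f ⟩
  sum (map T (spots (suc n)))                        ≡⟨ cong (sum ∘ map T) (spots-∷ʳ n) ⟩
  sum (map T (spots n ++ [ suc n ]))                 ≡⟨ cong sum (map-++ T (spots n) [ suc n ]) ⟩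
  sum (map T (spots n) ++ [ T (suc n) ])             ≡⟨ sum-++ (map T (spots n)) [ T (suc n) ] ⟩
  sum (map T (spots n)) + (T (suc n) + 0)
    ≡⟨ cong₂ _+_ (cong sum (map-cong T-restrict (spots n))) (cong (_+ 0) T-beyond) ⟩
  sum (map (λ p → ∑seq n m (λ τ → f (p ∷ τ))) (spots n)) + 0  ≡⟨ +-identityʳ _ ⟩
  sum (map (λ p → ∑seq n m (λ τ → f (p ∷ τ))) (spots n))      ≡⟨ ∑seq-suc n m f ⟨
  ∑seq n (suc m) f                                   ∎
  where
  open ≡-Reasoning
  T : ℕ → ℕ
  T p = ∑seq (suc n) m (λ τ → f (p ∷ τ))
  T-restrict : ∀ p → T p ≡ ∑seq n m (λ τ → f (p ∷ τ))
  T-restrict p = ∑seq-restrict n m (f-out ∘ there)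
  T-beyond : T (suc n) ≡ 0
  T-beyond = sum-map-zero (λ τ → f-out (here (n<1+n n))) (sequences m (suc n))

isFree : List ℕ → ℕ → Bool
isFree occ x = not (memberᵇ x occ)

record IsFirstFree (n : ℕ) (occ : List ℕ) (p s : ℕ) : Set where
  field
    1≤s     : 1 ≤ s
    s≤n     : s ≤ n
    p≤s     : p ≤ s
    s-free  : memberᵇ s occ ≡ false
    skipped : ∀ {j} → 1 ≤ j → p ≤ j → j < s → memberᵇ j occ ≡ true

firstFree-spec : ∀ n occ p {s} → firstFree n occ p ≡ just s → IsFirstFree n occ p s
firstFree-spec n occ p eq
  with head-filterᵇ-interval g 0 n (subst (λ xs → headM (filterᵇ g xs) ≡ just _) (spots≡interval n) eq)
  where
  g : ℕ → Bool
  g x = (p ≤ᵇ x) ∧ isFree occ x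
... | 0<s , s≤n , gs , skipped = record
  { 1≤s     = 0<s
  ; s≤n     = s≤n
  ; p≤s     = ≤ᵇ-true⇒≤ (∧-conicalˡ _ _ gs)
  ; s-free  = not-flip (∧-conicalʳ _ _ gs)
  ; skipped = λ {j} 0<j p≤j j<s →
      not-flip (subst (λ b → (b ∧ isFree occ j) ≡ false) (≤⇒≤ᵇ-true p≤j) (skipped 0<j j<s))
  }
  where
  not-flip : ∀ {a b} → not a ≡ b → a ≡ not b
  not-flip {a} eq = trans (sym (not-involutive a)) (cong not eq)

firstFree-from : ∀ n occ q d → q + d ≡ n → firstFree n occ (suc q) ≡ headM (filterᵇ (isFree occ) (interval q d))
firstFree-from n occ q d q+d≡n = cong headM (begin
    filterᵇ g (spots n)
  ≡⟨ cong (filterᵇ g) (trans (spots≡interval n) (trans (cong (interval 0) (sym q+d≡n)) (interval-++ 0 q d))) ⟩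
    filterᵇ g (interval 0 q ++ interval q d)
  ≡⟨ filterᵇ-++ g (interval 0 q) (interval q d) ⟩
    filterᵇ g (interval 0 q) ++ filterᵇ g (interval q d)
  ≡⟨ cong₂ _++_ (filterᵇ-below (isFree occ) (suc q) 0 q ≤-refl)
                (filterᵇ-cong-All (λ {x} x∈ → cong (_∧ isFree occ x) (≤⇒≤ᵇ-true (proj₁ x∈))) (interval-bounds q d)) ⟩
    filterᵇ (isFree occ) (interval q d) ∎)
  where
  open ≡-Reasoning
  g : ℕ → Bool
  g x = (suc q ≤ᵇ x) ∧ isFree occ x

parkAll-∷-inv : ∀ n occ p ps {pos} → parkAll n occ (p ∷ ps) ≡ just pos →
  Σ[ s ∈ ℕ ] Σ[ pos′ ∈ List ℕ ]
    firstFree n occ p ≡ just s × parkAll n (s ∷ occ) ps ≡ just pos′ × pos ≡ s ∷ pos′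
parkAll-∷-inv n occ p ps eq with firstFree n occ p in ff | eq
... | nothing | ()
... | just s  | eq₁ with parkAll n (s ∷ occ) ps in pa | eq₁
...   | nothing   | ()
...   | just pos′ | refl = s , pos′ , refl , pa , refl

length-parkAll : ∀ n occ π {pos} → parkAll n occ π ≡ just pos → length pos ≡ length π
length-parkAll n occ []       refl = refl
length-parkAll n occ (p ∷ ps) eq with parkAll-∷-inv n occ p ps eq
... | s , pos′ , _ , eq′ , refl = cong suc (length-parkAll n (s ∷ occ) ps eq′)

-- A car passes only over occupied spots, so a spot that starts free is attempted exactly when
-- some car parks on it.
attemptedᵇ-parkAll : ∀ n occ π {pos} → parkAll n occ π ≡ just pos →
  ∀ {j} → 1 ≤ j → memberᵇ j occ ≡ false → attemptedᵇ j π pos ≡ memberᵇ j pos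
attemptedᵇ-parkAll n occ []       refl _ _ = refl
attemptedᵇ-parkAll n occ (p ∷ ps) eq {j} 1≤j j-free with parkAll-∷-inv n occ p ps eq
... | s , pos′ , ff , eq′ , refl with firstFree-spec n occ p ff | j ≟ s
...   | spec | yes refl rewrite ≡ᵇ-refl j | ≤⇒≤ᵇ-true (IsFirstFree.p≤s spec) | ≤⇒≤ᵇ-true (≤-refl {j}) = refl
...   | spec | no j≢s rewrite ≢⇒≡ᵇ-false j≢s
  | attemptedᵇ-parkAll n (s ∷ occ) ps eq′ 1≤j (memberᵇ-∷-false {ys = occ} j≢s j-free)
  = cong (_∨ memberᵇ j pos′) not-passed
  where
  not-passed : ((p ≤ᵇ j) ∧ (j ≤ᵇ s)) ≡ false
  not-passed with p ≤ᵇ j in p≤j | j ≤ᵇ s in j≤s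
  ... | false | _     = refl
  ... | true  | false = refl
  ... | true  | true
    with () ← trans (sym (IsFirstFree.skipped spec 1≤j (≤ᵇ-true⇒≤ p≤j) (≤∧≢⇒< (≤ᵇ-true⇒≤ j≤s) j≢s))) j-free

length-free-∷ : ∀ s occ → memberᵇ s occ ≡ false → ∀ xs →
  length (filterᵇ (isFree occ) xs) ≡ length (filterᵇ (isFree (s ∷ occ)) xs) + count s xs
length-free-∷ s occ s-free []       = refl
length-free-∷ s occ s-free (x ∷ xs) with x ≟ s
... | yes refl rewrite ≡ᵇ-refl x | s-free = trans (cong suc (length-free-∷ x occ s-free xs)) (sym (+-suc _ _))
... | no x≢s rewrite ≢⇒≡ᵇ-false x≢s with memberᵇ x occ
...   | true  = length-free-∷ s occ s-free xs
...   | false = cong suc (length-free-∷ s occ s-free xs)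

length-free-parkAll : ∀ n occ π {pos} → parkAll n occ π ≡ just pos →
  length (filterᵇ (isFree occ) (spots n)) ≡ length (filterᵇ (λ x → isFree occ x ∧ isFree pos x) (spots n)) + length pos
length-free-parkAll n occ [] refl =
  trans (cong length (filterᵇ-cong (λ x → sym (∧-identityʳ (isFree occ x))) (spots n))) (sym (+-identityʳ _))
length-free-parkAll n occ (p ∷ ps) eq with parkAll-∷-inv n occ p ps eq
... | s , pos′ , ff , eq′ , refl with firstFree-spec n occ p ff
...   | spec = begin
    length (filterᵇ (isFree occ) (spots n))
  ≡⟨ length-free-∷ s occ (IsFirstFree.s-free spec) (spots n) ⟩
    length (filterᵇ (isFree (s ∷ occ)) (spots n)) + count s (spots n)
  ≡⟨ cong₂ _+_ (length-free-parkAll n (s ∷ occ) ps eq′) s-once ⟩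
    length (filterᵇ (λ x → isFree (s ∷ occ) x ∧ isFree pos′ x) (spots n)) + length pos′ + 1
  ≡⟨ cong (λ xs → length xs + length pos′ + 1)
          (filterᵇ-cong (λ x → move-s (x ≡ᵇ s) (memberᵇ x occ) (memberᵇ x pos′)) (spots n)) ⟩
    length (filterᵇ (λ x → isFree occ x ∧ isFree (s ∷ pos′) x) (spots n)) + length pos′ + 1
  ≡⟨ trans (+-assoc E (length pos′) 1) (cong (E +_) (+-comm (length pos′) 1)) ⟩
    length (filterᵇ (λ x → isFree occ x ∧ isFree (s ∷ pos′) x) (spots n)) + length (s ∷ pos′) ∎
  where
  open ≡-Reasoning
  E : ℕ
  E = length (filterᵇ (λ x → isFree occ x ∧ isFree (s ∷ pos′) x) (spots n))
  s-once : count s (spots n) ≡ 1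
  s-once = trans (cong (count s) (spots≡interval n))
                 (count-interval-inside s 0 n (IsFirstFree.1≤s spec) (IsFirstFree.s≤n spec))
  move-s : ∀ a b c → (not (a ∨ b) ∧ not c) ≡ (not b ∧ not (a ∨ c))
  move-s true  true  c = refl
  move-s true  false c = refl
  move-s false b     c = refl

parkAll-beyond : ∀ n occ p ps → n < p → parkAll n occ (p ∷ ps) ≡ nothing
parkAll-beyond n occ p ps n<p
  rewrite spots≡interval n | filterᵇ-below (isFree occ) p 0 n n<p = refl

parkAll-any-beyond : ∀ n occ {π} → Any (n <_) π → parkAll n occ π ≡ nothing
parkAll-any-beyond n occ {p ∷ ps} (here n<p)  = parkAll-beyond n occ p ps n<p
parkAll-any-beyond n occ {p ∷ ps} (there any) with firstFree n occ p
... | nothing = refl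
... | just s rewrite parkAll-any-beyond n (s ∷ occ) any = refl

-- The spots 1, …, N = n + 1 on a circle: next and prev are the cyclic successor and predecessor
-- on 1, …, N and fix every other number, so that they are inverse bijections of ℕ.
module Circle (n : ℕ) where

  N : ℕ
  N = suc n

  next : ℕ → ℕ
  next zero = zero
  next (suc x) with <-cmp x n
  ... | tri< _ _ _ = suc (suc x)
  ... | tri≈ _ _ _ = 1
  ... | tri> _ _ _ = suc x

  prev : ℕ → ℕ
  prev zero             = zero
  prev (suc zero)       = N
  prev (suc (suc y)) with <-cmp y n
  ... | tri< _ _ _ = suc y
  ... | tri≈ _ _ _ = suc (suc y)
  ... | tri> _ _ _ = suc (suc y)

  next-< : ∀ {x} → x < n → next (suc x) ≡ suc (suc x)
  next-< {x} x<n with <-cmp x n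
  ... | tri< _ _ _    = refl
  ... | tri≈ _ x≡n _  = ⊥-elim (<⇒≢ x<n x≡n)
  ... | tri> _ _ x>n  = ⊥-elim (<-asym x<n x>n)

  next-N : next N ≡ 1
  next-N with <-cmp n n
  ... | tri< n<n _ _ = ⊥-elim (<-irrefl refl n<n)
  ... | tri≈ _ _ _   = refl
  ... | tri> _ _ n>n = ⊥-elim (<-irrefl refl n>n)

  next-> : ∀ {x} → n < x → next (suc x) ≡ suc x
  next-> {x} x>n with <-cmp x n
  ... | tri< x<n _ _ = ⊥-elim (<-asym x>n x<n)
  ... | tri≈ _ x≡n _ = ⊥-elim (<⇒≢ x>n (sym x≡n))
  ... | tri> _ _ _   = refl

  prev-< : ∀ {y} → y < n → prev (suc (suc y)) ≡ suc y
  prev-< {y} y<n with <-cmp y n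
  ... | tri< _ _ _   = refl
  ... | tri≈ _ y≡n _ = ⊥-elim (<⇒≢ y<n y≡n)
  ... | tri> _ _ y>n = ⊥-elim (<-asym y<n y>n)

  prev-≥ : ∀ {y} → n ≤ y → prev (suc (suc y)) ≡ suc (suc y)
  prev-≥ {y} n≤y with <-cmp y n
  ... | tri< y<n _ _ = ⊥-elim (<⇒≱ y<n n≤y)
  ... | tri≈ _ _ _   = refl
  ... | tri> _ _ _   = refl

  prev-next : ∀ x → prev (next x) ≡ x
  prev-next zero    = refl
  prev-next (suc x) with <-cmp x n
  ... | tri< x<n _ _  = prev-< x<n
  ... | tri≈ _ refl _ = refl
  prev-next (suc (suc y)) | tri> _ _ y≥n = prev-≥ (≤-pred y≥n)

  next-prev : ∀ x → next (prev x) ≡ x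
  next-prev zero          = refl
  next-prev (suc zero)    = next-N
  next-prev (suc (suc y)) with <-cmp y n
  ... | tri< y<n _ _  = next-< y<n
  ... | tri≈ _ refl _ = next-> (n<1+n n)
  ... | tri> _ _ y>n  = next-> (m<n⇒m<1+n y>n)

  prev-injective : ∀ {x y} → prev x ≡ prev y → x ≡ y
  prev-injective {x} {y} eq = trans (sym (next-prev x)) (trans (cong next eq) (next-prev y))

  memberᵇ-map-prev : ∀ x ys → memberᵇ (prev x) (map prev ys) ≡ memberᵇ x ys
  memberᵇ-map-prev x []       = refl
  memberᵇ-map-prev x (y ∷ ys) with x ≟ y
  ... | yes refl rewrite ≡ᵇ-refl x | ≡ᵇ-refl (prev x) = refl
  ... | no x≢y rewrite ≢⇒≡ᵇ-false x≢y | ≢⇒≡ᵇ-false (x≢y ∘ prev-injective) = memberᵇ-map-prev x ys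

  circFirstFree : ℕ → List ℕ → ℕ → ℕ
  circFirstFree zero    occ p = p
  circFirstFree (suc f) occ p = if memberᵇ p occ then circFirstFree f occ (next p) else p

  circParkFrom : List ℕ → List ℕ → List ℕ
  circParkFrom occ []       = []
  circParkFrom occ (p ∷ ps) = circFirstFree N occ p ∷ circParkFrom (circFirstFree N occ p ∷ occ) ps

  circPark : List ℕ → List ℕ
  circPark = circParkFrom []

  circFirstFree-prev : ∀ f occ p → circFirstFree f (map prev occ) (prev p) ≡ prev (circFirstFree f occ p)
  circFirstFree-prev zero    occ p = refl
  circFirstFree-prev (suc f) occ p rewrite memberᵇ-map-prev p occ with memberᵇ p occ
  ... | true  = trans (cong (circFirstFree f (map prev occ)) (trans (next-prev p) (sym (prev-next p))))
                      (circFirstFree-prev f occ (next p))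
  ... | false = refl

  circParkFrom-prev : ∀ occ ps → circParkFrom (map prev occ) (map prev ps) ≡ map prev (circParkFrom occ ps)
  circParkFrom-prev occ []       = refl
  circParkFrom-prev occ (p ∷ ps) rewrite circFirstFree-prev N occ p =
    cong (prev (circFirstFree N occ p) ∷_) (circParkFrom-prev (circFirstFree N occ p ∷ occ) ps)

  rotate : ℕ → List ℕ → List ℕ
  rotate zero    σ = σ
  rotate (suc c) σ = rotate c (map prev σ)

  circPark-rotate : ∀ c σ → circPark (rotate c σ) ≡ rotate c (circPark σ)
  circPark-rotate zero    σ = refl
  circPark-rotate (suc c) σ = trans (circPark-rotate c (map prev σ)) (cong (rotate c) (circParkFrom-prev [] σ))

  next^ : ℕ → ℕ → ℕ
  next^ zero    x = x
  next^ (suc c) x = next (next^ c x)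

  memberᵇ-rotate : ∀ c x ys → memberᵇ x (rotate c ys) ≡ memberᵇ (next^ c x) ys
  memberᵇ-rotate zero    x ys = refl
  memberᵇ-rotate (suc c) x ys = begin
    memberᵇ x (rotate c (map prev ys))                 ≡⟨ memberᵇ-rotate c x (map prev ys) ⟩
    memberᵇ (next^ c x) (map prev ys)                  ≡⟨ cong (λ y → memberᵇ y (map prev ys)) (sym (prev-next (next^ c x))) ⟩
    memberᵇ (prev (next (next^ c x))) (map prev ys)    ≡⟨ memberᵇ-map-prev (next (next^ c x)) ys ⟩
    memberᵇ (next^ (suc c) x) ys                       ∎
    where open ≡-Reasoning

  next^-+ : ∀ a b x → next^ (a + b) x ≡ next^ a (next^ b x)
  next^-+ zero    b x = refl
  next^-+ (suc a) b x = cong next (next^-+ a b x)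

  next^-N : ∀ {x} → x ≤ n → next^ (suc x) N ≡ suc x
  next^-N {zero}  _   = next-N
  next^-N {suc x} x<n = trans (cong next (next^-N (<⇒≤ x<n))) (next-< x<n)

  next^-periodic : ∀ y → next^ (N + y) N ≡ next^ y N
  next^-periodic y = trans (cong (λ c → next^ c N) (+-comm N y)) (trans (next^-+ y N N) (cong (next^ y) (next^-N ≤-refl)))

  InCircle : ℕ → Set
  InCircle x = 1 ≤ x × x ≤ N

  prev-InCircle : ∀ {x} → InCircle x → InCircle (prev x)
  prev-InCircle {suc zero}    _           = s≤s z≤n , ≤-refl
  prev-InCircle {suc (suc y)} (_ , y+2≤N) rewrite prev-< (≤-pred y+2≤N) = s≤s z≤n , m≤n⇒m≤1+n (≤-pred y+2≤N)

  rotate-InCircle : ∀ c {σ} → All InCircle σ → All InCircle (rotate c σ)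
  rotate-InCircle zero    bounds = bounds
  rotate-InCircle (suc c) bounds = rotate-InCircle c (map⁺ (All.map prev-InCircle bounds))

  length-rotate : ∀ c σ → length (rotate c σ) ≡ length σ
  length-rotate zero    σ = refl
  length-rotate (suc c) σ = trans (length-rotate c (map prev σ)) (length-map prev σ)

  map-prev-interval : ∀ a d → a + d ≤ n → map prev (interval (suc a) d) ≡ interval a d
  map-prev-interval a zero    _     = refl
  map-prev-interval a (suc d) a+d≤n with a+1+d≤n ← subst (_≤ n) (+-suc a d) a+d≤n =
    cong₂ _∷_ (prev-< (≤-trans (s≤s (m≤m+n a d)) a+1+d≤n)) (map-prev-interval (suc a) d a+1+d≤n)

  map-prev-spots : map prev (spots N) ≡ N ∷ spots n
  map-prev-spots = begin
    map prev (spots N)                ≡⟨ cong (map prev) (spots≡interval N) ⟩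
    N ∷ map prev (interval 1 n)       ≡⟨ cong (N ∷_) (map-prev-interval 0 n ≤-refl) ⟩
    N ∷ interval 0 n                  ≡⟨ cong (N ∷_) (sym (spots≡interval n)) ⟩
    N ∷ spots n                       ∎
    where open ≡-Reasoning

  sum-spots-prev : ∀ (h : ℕ → ℕ) → sum (map h (spots N)) ≡ sum (map (h ∘ prev) (spots N))
  sum-spots-prev h = begin
    sum (map h (spots N))                 ≡⟨ cong (sum ∘ map h) (spots-∷ʳ n) ⟩
    sum (map h (spots n ++ [ N ]))        ≡⟨ cong sum (map-++ h (spots n) [ N ]) ⟩
    sum (map h (spots n) ++ [ h N ])      ≡⟨ sum-++ (map h (spots n)) [ h N ] ⟩
    sum (map h (spots n)) + (h N + 0)     ≡⟨ +-comm _ (h N + 0) ⟩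
    h N + 0 + sum (map h (spots n))       ≡⟨ cong (_+ sum (map h (spots n))) (+-identityʳ (h N)) ⟩
    sum (map h (N ∷ spots n))             ≡⟨ cong (sum ∘ map h) (sym map-prev-spots) ⟩
    sum (map h (map prev (spots N)))      ≡⟨ cong sum (sym (map-∘ (spots N))) ⟩
    sum (map (h ∘ prev) (spots N))        ∎
    where open ≡-Reasoning

  circFirstFree-N : ∀ f occ → memberᵇ N occ ≡ false → circFirstFree f occ N ≡ N
  circFirstFree-N zero    occ _      = refl
  circFirstFree-N (suc f) occ N-free rewrite N-free = refl

  circFirstFree-interval : ∀ occ → memberᵇ N occ ≡ false → ∀ q d f → q + d ≡ n → d ≤ f →
    circFirstFree f occ (suc q) ≡ fromMaybe N (headM (filterᵇ (isFree occ) (interval q d)))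
  circFirstFree-interval occ N-free q zero f q+0≡n _ rewrite +-identityʳ q | q+0≡n = circFirstFree-N f occ N-free
  circFirstFree-interval occ N-free q (suc d) (suc f) q+d≡n (s≤s d≤f) with memberᵇ (suc q) occ
  ... | false = refl
  ... | true rewrite next-< (subst (q <_) q+d≡n (m<m+n q z<s)) =
    circFirstFree-interval occ N-free (suc q) d f (trans (sym (+-suc q d)) q+d≡n) d≤f

  circFirstFree≡firstFree : ∀ occ → memberᵇ N occ ≡ false → ∀ {p} → 1 ≤ p → p ≤ n →
    circFirstFree N occ p ≡ fromMaybe N (firstFree n occ p)
  circFirstFree≡firstFree occ N-free {suc q} _ q<n =
    trans (circFirstFree-interval occ N-free q (n ∸ q) N q+[n∸q]≡n (m≤n⇒m≤1+n (m∸n≤m n q)))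
          (cong (fromMaybe N) (sym (firstFree-from n occ q (n ∸ q) q+[n∸q]≡n)))
    where
    q+[n∸q]≡n : q + (n ∸ q) ≡ n
    q+[n∸q]≡n = m+[n∸m]≡n (<⇒≤ q<n)

  -- A linear search that runs past n is exactly a circular search that reaches the free spot N.
  parkAll≡circParkFrom : ∀ occ σ → All InCircle σ → memberᵇ N occ ≡ false →
    parkAll n occ σ ≡ (if memberᵇ N (circParkFrom occ σ) then nothing else just (circParkFrom occ σ))
  parkAll≡circParkFrom occ []       _                      _      = refl
  parkAll≡circParkFrom occ (p ∷ ps) ((1≤p , p≤N) ∷ bounds) N-free with p ≤? n
  ... | no p≰n with refl ← ≤-antisym p≤N (≰⇒> p≰n)
    rewrite circFirstFree-N N occ N-free | ≡ᵇ-refl N = parkAll-beyond n occ N ps (n<1+n n)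
  ... | yes p≤n with firstFree n occ p in ff | circFirstFree≡firstFree occ N-free 1≤p p≤n
  ...   | nothing | cf≡N rewrite cf≡N | ≡ᵇ-refl N = refl
  ...   | just t  | cf≡t
    with N≢t ← (λ N≡t → <-irrefl (sym N≡t) (s≤s (IsFirstFree.s≤n (firstFree-spec n occ p ff))))
    rewrite cf≡t | ≢⇒≡ᵇ-false N≢t
    | parkAll≡circParkFrom (t ∷ occ) ps bounds (memberᵇ-∷-false {ys = occ} N≢t N-free)
    = consM-if (memberᵇ N (circParkFrom (t ∷ occ) ps))
    where
    consM-if : ∀ b {xs} → consM t (if b then nothing else just xs) ≡ (if b then nothing else just (t ∷ xs))
    consM-if true  = refl
    consM-if false = refl

  ∑seq-map-prev : ∀ m f → ∑seq N m f ≡ ∑seq N m (f ∘ map prev)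
  ∑seq-map-prev zero    f = refl
  ∑seq-map-prev (suc m) f = begin
    ∑seq N (suc m) f
      ≡⟨ ∑seq-suc N m f ⟩
    sum (map (λ p → ∑seq N m (λ τ → f (p ∷ τ))) (spots N))
      ≡⟨ sum-spots-prev (λ p → ∑seq N m (λ τ → f (p ∷ τ))) ⟩
    sum (map (λ p → ∑seq N m (λ τ → f (prev p ∷ τ))) (spots N))
      ≡⟨ cong sum (map-cong (λ p → ∑seq-map-prev m (λ τ → f (prev p ∷ τ))) (spots N)) ⟩
    sum (map (λ p → ∑seq N m (λ τ → f (prev p ∷ map prev τ))) (spots N))
      ≡⟨ ∑seq-suc N m (f ∘ map prev) ⟨
    ∑seq N (suc m) (f ∘ map prev) ∎
    where open ≡-Reasoning

  ∑seq-rotate : ∀ m c f → ∑seq N m f ≡ ∑seq N m (f ∘ rotate c)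
  ∑seq-rotate m zero    f = refl
  ∑seq-rotate m (suc c) f = trans (∑seq-rotate m c f) (∑seq-map-prev m (f ∘ rotate c))

  ∑seq-orbit : ∀ m g → N * ∑seq N m g ≡ ∑seq N m (λ σ → sum (map (λ c → g (rotate c σ)) (spots N)))
  ∑seq-orbit m g = begin
    N * ∑seq N m g                                         ≡⟨ cong (_* ∑seq N m g) (sym (length-spots N)) ⟩
    length (spots N) * ∑seq N m g                          ≡⟨ sum-map-const (∑seq N m g) (spots N) ⟨
    sum (map (λ _ → ∑seq N m g) (spots N))                 ≡⟨ cong sum (map-cong (λ c → ∑seq-rotate m c g) (spots N)) ⟩
    sum (map (λ c → ∑seq N m (g ∘ rotate c)) (spots N))
      ≡⟨ sum-map-sum-comm (λ c σ → g (rotate c σ)) (spots N) (sequences m N) ⟩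
    ∑seq N m (λ σ → sum (map (λ c → g (rotate c σ)) (spots N))) ∎
    where open ≡-Reasoning

module Expectation (n m : ℕ) where
  open Circle n

  isEmpty : List ℕ → ℕ → Bool
  isEmpty σ = isFree (circPark σ)

  emptySpots : List ℕ → List ℕ
  emptySpots σ = filterᵇ (isEmpty σ) (spots N)

  sum-PF : ∀ (F G : List ℕ → ℕ) →
    (∀ {σ} → All InCircle σ → length σ ≡ m → parkAll n [] σ ≡ just (circPark σ) → F σ ≡ G σ) →
    sum (map F (PF m n)) ≡ ∑seq N m (λ σ → if isEmpty σ N then G σ else 0)
  sum-PF F G F≗G = begin
    sum (map F (PF m n))                                    ≡⟨ sum-map-filterᵇ (isPF n) F (sequences m n) ⟩
    ∑seq n m (λ σ → if isPF n σ then F σ else 0)            ≡⟨ ∑seq-restrict n m not-PF ⟨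
    ∑seq N m (λ σ → if isPF n σ then F σ else 0)            ≡⟨ ∑seq-cong N m PF⇔N-empty ⟩
    ∑seq N m (λ σ → if isEmpty σ N then G σ else 0)         ∎
    where
    open ≡-Reasoning
    not-PF : ∀ {σ} → Any (n <_) σ → (if isPF n σ then F σ else 0) ≡ 0
    not-PF any rewrite parkAll-any-beyond n [] any = refl
    PF⇔N-empty : ∀ {σ} → All InCircle σ → length σ ≡ m →
                 (if isPF n σ then F σ else 0) ≡ (if isEmpty σ N then G σ else 0)
    PF⇔N-empty {σ} bounds |σ| with parkAll≡circParkFrom [] σ bounds refl
    ... | pa with memberᵇ N (circPark σ)
    ...   | true  rewrite pa = refl
    ...   | false rewrite pa = F≗G bounds |σ| pa

  length-emptySpots-PF : ∀ {σ} → length σ ≡ m → parkAll n [] σ ≡ just (circPark σ) →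
    length (filterᵇ (isEmpty σ) (spots n)) ≡ n ∸ m
  length-emptySpots-PF {σ} |σ| pa = begin
    E                                 ≡⟨ m+n∸n≡m E m ⟨
    E + m ∸ m                         ≡⟨ cong (λ l → E + l ∸ m) (trans (length-parkAll n [] σ pa) |σ|) ⟨
    E + length (circPark σ) ∸ m       ≡⟨ cong (_∸ m) (length-free-parkAll n [] σ pa) ⟨
    length (filterᵇ (λ _ → true) (spots n)) ∸ m ≡⟨ cong (λ xs → length xs ∸ m) (filterᵇ-accept (spots n)) ⟩
    length (spots n) ∸ m              ≡⟨ cong (_∸ m) (length-spots n) ⟩
    n ∸ m                             ∎
    where
    open ≡-Reasoning
    E : ℕ
    E = length (filterᵇ (isEmpty σ) (spots n))

  emptySpots-split : ∀ σ → emptySpots σ ≡ filterᵇ (isEmpty σ) (spots n) ++ filterᵇ (isEmpty σ) [ N ]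
  emptySpots-split σ = trans (cong (filterᵇ (isEmpty σ)) (spots-∷ʳ n)) (filterᵇ-++ (isEmpty σ) (spots n) [ N ])

  length-emptySpots : ∀ {σ} → length σ ≡ m → parkAll n [] σ ≡ just (circPark σ) → isEmpty σ N ≡ true →
    length (emptySpots σ) ≡ n ∸ m + 1
  length-emptySpots {σ} |σ| pa N-empty = begin
    length (emptySpots σ)                                           ≡⟨ cong length (emptySpots-split σ) ⟩
    length (filterᵇ (isEmpty σ) (spots n) ++ filterᵇ (isEmpty σ) [ N ]) ≡⟨ length-++ (filterᵇ (isEmpty σ) (spots n)) ⟩
    length (filterᵇ (isEmpty σ) (spots n)) + length (filterᵇ (isEmpty σ) [ N ])
      ≡⟨ cong₂ _+_ (length-emptySpots-PF |σ| pa) (cong (λ b → length (if b then N ∷ [] else [])) N-empty) ⟩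
    n ∸ m + 1                                                       ∎
    where open ≡-Reasoning

  k≡emptySpots : ∀ {j σ} → j < n ∸ m → length σ ≡ m → parkAll n [] σ ≡ just (circPark σ) →
    k n (suc j) σ ≡ nthOr0 j (emptySpots σ)
  k≡emptySpots {j} {σ} j<n∸m |σ| pa rewrite pa = begin
    nthOr0 j (filterᵇ (λ x → not (attemptedᵇ x σ (circPark σ))) (spots n))
      ≡⟨ cong (nthOr0 j) (filterᵇ-cong-All (λ x∈ → cong not (attemptedᵇ-parkAll n [] σ pa (proj₁ x∈) refl))
                                            (spots-bounds n)) ⟩
    nthOr0 j (filterᵇ (isEmpty σ) (spots n))
      ≡⟨ nthOr0-++ˡ j (filterᵇ (isEmpty σ) (spots n)) _ (subst (j <_) (sym (length-emptySpots-PF |σ| pa)) j<n∸m) ⟨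
    nthOr0 j (filterᵇ (isEmpty σ) (spots n) ++ filterᵇ (isEmpty σ) [ N ])
      ≡⟨ cong (nthOr0 j) (emptySpots-split σ) ⟨
    nthOr0 j (emptySpots σ) ∎
    where open ≡-Reasoning

  isEmpty-rotate : ∀ c σ x → isEmpty (rotate c σ) x ≡ isEmpty σ (next^ c x)
  isEmpty-rotate c σ x = cong not (trans (cong (memberᵇ x) (circPark-rotate c σ)) (memberᵇ-rotate c x (circPark σ)))

  -- Mark c when rotating σ by c leaves spot N empty; the marks of σ repeat with period N.
  module Orbit (σ : List ℕ) = PeriodicMarks N (λ c → isEmpty σ (next^ c N)) (λ y → cong (isEmpty σ) (next^-periodic y))

  emptySpots-rotate : ∀ c σ → emptySpots (rotate c σ) ≡ Orbit.offsets σ c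
  emptySpots-rotate c σ = trans (cong (filterᵇ (isEmpty (rotate c σ))) (spots≡interval N))
                                (filterᵇ-cong-All shifted (interval-bounds 0 N))
    where
    shifted : ∀ {x} → 0 < x × x ≤ 0 + N → isEmpty (rotate c σ) x ≡ isEmpty σ (next^ (c + x) N)
    shifted {suc x} (_ , x<N) = trans (isEmpty-rotate c σ (suc x))
      (cong (isEmpty σ) (trans (cong (next^ c) (sym (next^-N (≤-pred x<N)))) (sym (next^-+ c (suc x) N))))

  parkAll-N-empty : ∀ {σ} → All InCircle σ → isEmpty σ N ≡ true → parkAll n [] σ ≡ just (circPark σ)
  parkAll-N-empty {σ} bounds N-empty with memberᵇ N (circPark σ) | parkAll≡circParkFrom [] σ bounds refl | N-empty
  ... | false | pa | _  = pa
  ... | true  | _  | ()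

  length-marks : ∀ {σ} → All InCircle σ → length σ ≡ m → ∀ {c₀ rest} → Orbit.marks σ ≡ c₀ ∷ rest →
    length (Orbit.marks σ) ≡ n ∸ m + 1
  length-marks {σ} bounds |σ| {c₀} marks≡
    with _ , c₀≤N , marked-c₀ , _ ← head-filterᵇ-interval _ 0 N (cong headM marks≡) = begin
      length (Orbit.marks σ)              ≡⟨ Orbit.length-offsets σ c₀≤N ⟨
      length (Orbit.offsets σ c₀)         ≡⟨ cong length (emptySpots-rotate c₀ σ) ⟨
      length (emptySpots (rotate c₀ σ))
        ≡⟨ length-emptySpots (trans (length-rotate c₀ σ) |σ|) (parkAll-N-empty (rotate-InCircle c₀ bounds) N-empty) N-empty ⟩
      n ∸ m + 1                           ∎
    where
    open ≡-Reasoning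
    N-empty : isEmpty (rotate c₀ σ) N ≡ true
    N-empty = trans (isEmpty-rotate c₀ σ N) marked-c₀

  χPF : List ℕ → ℕ
  χPF σ = if isEmpty σ N then 1 else 0

  kPF : ℕ → List ℕ → ℕ
  kPF j σ = if isEmpty σ N then nthOr0 j (emptySpots σ) else 0

  sum-orbit-χPF : ∀ σ → sum (map (λ c → χPF (rotate c σ)) (spots N)) ≡ length (Orbit.marks σ)
  sum-orbit-χPF σ = begin
    sum (map (λ c → χPF (rotate c σ)) (spots N))
      ≡⟨ cong sum (map-cong (λ c → cong (λ b → if b then 1 else 0) (isEmpty-rotate c σ N)) (spots N)) ⟩
    sum (map χ (spots N))
      ≡⟨ cong (sum ∘ map χ) (spots≡interval N) ⟩
    sum (map χ (interval 0 N))
      ≡⟨ length-filterᵇ (λ c → isEmpty σ (next^ c N)) (interval 0 N) ⟨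
    length (Orbit.marks σ) ∎
    where
    open ≡-Reasoning
    χ : ℕ → ℕ
    χ c = if isEmpty σ (next^ c N) then 1 else 0

  sum-orbit-kPF : ∀ j σ → sum (map (λ c → kPF j (rotate c σ)) (spots N))
                          ≡ sum (map (λ c → if isEmpty σ (next^ c N) then Orbit.gap σ j c else 0) (interval 0 N))
  sum-orbit-kPF j σ = trans (cong (sum ∘ map (λ c → kPF j (rotate c σ))) (spots≡interval N))
                            (cong sum (map-cong rotated (interval 0 N)))
    where
    rotated : ∀ c → kPF j (rotate c σ) ≡ (if isEmpty σ (next^ c N) then Orbit.gap σ j c else 0)
    rotated c rewrite isEmpty-rotate c σ N | emptySpots-rotate c σ = refl

  -- Every orbit containing a parking function has exactly n − m + 1 of them (one per empty spot),
  -- and summing their (j + 1)-th empty spots gives (j + 1)·N.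
  orbit-identity : ∀ {j σ} → j < n ∸ m → All InCircle σ → length σ ≡ m →
    (n ∸ m + 1) * sum (map (λ c → kPF j (rotate c σ)) (spots N)) ≡ suc j * N * sum (map (λ c → χPF (rotate c σ)) (spots N))
  orbit-identity {j} {σ} j<n∸m bounds |σ| rewrite sum-orbit-kPF j σ | sum-orbit-χPF σ with Orbit.marks σ in marks≡
  ... | [] = trans (cong ((n ∸ m + 1) *_) no-gaps) (trans (*-zeroʳ (n ∸ m + 1)) (sym (*-zeroʳ (suc j * N))))
    where
    no-gaps : sum (map (λ c → if isEmpty σ (next^ c N) then Orbit.gap σ j c else 0) (interval 0 N)) ≡ 0
    no-gaps = trans (sym (sum-map-filterᵇ (λ c → isEmpty σ (next^ c N)) (Orbit.gap σ j) (interval 0 N)))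
                    (cong (sum ∘ map (Orbit.gap σ j)) marks≡)
  ... | c₀ ∷ rest = begin
    (n ∸ m + 1) * sum (map (λ c → if isEmpty σ (next^ c N) then Orbit.gap σ j c else 0) (interval 0 N))
      ≡⟨ cong ((n ∸ m + 1) *_) (Orbit.sum-gap σ (subst (j <_) (sym L≡) (<-≤-trans j<n∸m (m≤m+n (n ∸ m) 1)))) ⟩
    (n ∸ m + 1) * (suc j * N)                 ≡⟨ *-comm (n ∸ m + 1) (suc j * N) ⟩
    suc j * N * (n ∸ m + 1)                   ≡⟨ cong (λ l → suc j * N * l) (trans (cong length (sym marks≡)) L≡) ⟨
    suc j * N * length (c₀ ∷ rest)            ∎
    where
    open ≡-Reasoning
    L≡ : length (Orbit.marks σ) ≡ n ∸ m + 1
    L≡ = length-marks bounds |σ| {c₀} {rest} marks≡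

  ∑seq-kPF : ∀ {j} → j < n ∸ m → (n ∸ m + 1) * ∑seq N m (kPF j) ≡ suc j * N * ∑seq N m χPF
  ∑seq-kPF {j} j<n∸m = *-cancelˡ-≡ _ _ N (begin
    N * ((n ∸ m + 1) * ∑seq N m (kPF j))
      ≡⟨ x*[y*z]≡y*[x*z] N (n ∸ m + 1) _ ⟩
    (n ∸ m + 1) * (N * ∑seq N m (kPF j))
      ≡⟨ cong ((n ∸ m + 1) *_) (∑seq-orbit m (kPF j)) ⟩
    (n ∸ m + 1) * ∑seq N m (λ σ → sum (map (λ c → kPF j (rotate c σ)) (spots N)))
      ≡⟨ sum-map-*ˡ (n ∸ m + 1) (λ σ → sum (map (λ c → kPF j (rotate c σ)) (spots N))) (sequences m N) ⟨
    ∑seq N m (λ σ → (n ∸ m + 1) * sum (map (λ c → kPF j (rotate c σ)) (spots N)))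
      ≡⟨ ∑seq-cong N m (orbit-identity j<n∸m) ⟩
    ∑seq N m (λ σ → suc j * N * sum (map (λ c → χPF (rotate c σ)) (spots N)))
      ≡⟨ sum-map-*ˡ (suc j * N) (λ σ → sum (map (λ c → χPF (rotate c σ)) (spots N))) (sequences m N) ⟩
    suc j * N * ∑seq N m (λ σ → sum (map (λ c → χPF (rotate c σ)) (spots N)))
      ≡⟨ cong (suc j * N *_) (∑seq-orbit m χPF) ⟨
    suc j * N * (N * ∑seq N m χPF)
      ≡⟨ x*[y*z]≡y*[x*z] (suc j * N) N _ ⟩
    N * (suc j * N * ∑seq N m χPF) ∎)
    where open ≡-Reasoning

proposition3p16 : (m n : ℕ) → 1 ≤ m → m < n → (i : ℕ) → 1 ≤ i → i ≤ n ∸ m →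
    (n ∸ m + 1) * sum (map (k n i) (PF m n)) ≡ i * (n + 1) * length (PF m n)
proposition3p16 m n _ _ (suc j) _ j<n∸m = begin
  (n ∸ m + 1) * sum (map (k n (suc j)) (PF m n))  ≡⟨ cong ((n ∸ m + 1) *_) sum-k ⟩
  (n ∸ m + 1) * ∑seq N m (kPF j)                  ≡⟨ ∑seq-kPF j<n∸m ⟩
  suc j * N * ∑seq N m χPF                         ≡⟨ cong₂ (λ N′ s → suc j * N′ * s) (+-comm n 1) count-PF ⟨
  suc j * (n + 1) * length (PF m n)                ∎
  where
  open ≡-Reasoning
  open Circle n using (N)
  open Expectation n m
  sum-k : sum (map (k n (suc j)) (PF m n)) ≡ ∑seq N m (kPF j)
  sum-k = sum-PF (k n (suc j)) (λ σ → nthOr0 j (emptySpots σ)) (λ _ |σ| pa → k≡emptySpots j<n∸m |σ| pa)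
  count-PF : length (PF m n) ≡ ∑seq N m χPF
  count-PF = trans (length≡sum-map-1 (PF m n)) (sum-PF (λ _ → 1) (λ _ → 1) (λ _ _ _ → refl))
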